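{- Let $q$ be a prime power, $\alpha$ a primitive element of $\mathbf{F}_q$, $k$ an integer with $1\le k\le q-2$, $d=q-k$, $g(x)=(x-\alpha)(x-\alpha^2)\cdots(x-\alpha^{d-1})$ and $g_1(x)=g(x)/(x-\alpha)$. Let $u(x)=\sum_{i=0}^{q-2}u_ix^i\in\mathbf{F}_q[x]$ satisfy $u_{q-2}\ne 0$ and $u_i=0$ for all $k\le i\le q-3$. Then there exist $a\in\mathbf{F}_q^*$ and $l\in\mathbf{F}_q[x]$ with $\deg l\le k-1$ such that $a g_1(x)+l(x)g(x)$ is the DFT of $u(x)$.
   Context: For a polynomial $V(x)=\sum_{i=0}^{q-2}V_ix^i\in\mathbf{F}_q[x]$ of degree at most $q-2$, its discrete Fourier transform (DFT) is $\hat V(x)=\sum_{j=0}^{q-2}\hat V_jx^j$ with $\hat V_j=V(\alpha^j)=\sum_{i=0}^{q-2}V_i\alpha^{ij}$. -}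

module Defs where

open import Level using (_⊔_)
open import Function using (_∘_)
open import Algebra.Bundles using (CommutativeRing)
open import Data.Nat using (ℕ; zero; suc; _∸_) renaming (_*_ to _*ℕ_; _+_ to _+ℕ_; _^_ to _^ℕ_)
open import Data.Nat.Primality using (Prime)
open import Data.Fin using (Fin; toℕ)
open import Data.List using (List; []; _∷_; map)
open import Data.Product using (Σ; ∃; _×_; _,_)
open import Relation.Nullary using (¬_)
open import Relation.Binary.PropositionalEquality using (_≡_)

IsPrimePower : ℕ → Set
IsPrimePower q = Σ ℕ λ p → Σ ℕ λ e → Prime p × (q ≡ p ^ℕ suc e)

module FF {c ℓ} (R : CommutativeRing c ℓ) where
  open CommutativeRing R

  pow : Carrier → ℕ → Carrier
  pow x zero    = 1#
  pow x (suc n) = x * pow x n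

  sumF : ∀ n → (Fin n → Carrier) → Carrier
  sumF zero    f = 0#
  sumF (suc n) f = f Data.Fin.zero + sumF n (f ∘ Data.Fin.suc)

  IsField : Set (c ⊔ ℓ)
  IsField = ¬ (1# ≈ 0#) × (∀ x → ¬ (x ≈ 0#) → ∃ λ y → x * y ≈ 1#)

  HasSize : ℕ → Set (c ⊔ ℓ)
  HasSize q = Σ (Fin q → Carrier) λ e →
                (∀ x → ∃ λ i → e i ≈ x) × (∀ i j → e i ≈ e j → i ≡ j)

  IsPrimitive : Carrier → Set (c ⊔ ℓ)
  IsPrimitive α = ∀ x → ¬ (x ≈ 0#) → ∃ λ i → x ≈ pow α i

  -- Polynomials as coefficient lists (constant term first)
  Poly : Set c
  Poly = List Carrier

  coeff : Poly → ℕ → Carrier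
  coeff []       j       = 0#
  coeff (a ∷ p)  zero    = a
  coeff (a ∷ p)  (suc j) = coeff p j

  _≈P_ : Poly → Poly → Set ℓ
  p ≈P r = ∀ j → coeff p j ≈ coeff r j

  _+P_ : Poly → Poly → Poly
  []      +P r       = r
  (a ∷ p) +P []      = a ∷ p
  (a ∷ p) +P (b ∷ r) = (a + b) ∷ (p +P r)

  _·P_ : Carrier → Poly → Poly
  a ·P p = map (a *_) p

  _*P_ : Poly → Poly → Poly
  []      *P r = []
  (a ∷ p) *P r = (a ·P r) +P (0# ∷ (p *P r))

  fromFun : ∀ n → (Fin n → Carrier) → Poly
  fromFun zero    f = []
  fromFun (suc n) f = f Data.Fin.zero ∷ fromFun n (f ∘ Data.Fin.suc)

  xMinus : Carrier → Poly
  xMinus b = (- b) ∷ 1# ∷ []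

  prodRoots : Carrier → ℕ → ℕ → Poly
  prodRoots α m zero    = 1# ∷ []
  prodRoots α m (suc n) = xMinus (pow α m) *P prodRoots α (suc m) n

  gPoly : Carrier → ℕ → Poly
  gPoly α d = prodRoots α 1 (d ∸ 1)

  -- g₁(x) = g(x)/(x-α) = (x-α²)⋯(x-α^(d-1))   (d ≥ 2)
  g1Poly : Carrier → ℕ → Poly
  g1Poly α d = prodRoots α 2 (d ∸ 2)

  dft : Carrier → ∀ N → (Fin N → Carrier) → Poly
  dft α N V = fromFun N (λ j → sumF N (λ i → V i * pow α (toℕ i *ℕ toℕ j)))

{-# OPTIONS --safe #-}

-- Let N = q − 1 and U the DFT of u. Orthogonality of the powers of α gives
-- U(α^t) = u_{N−t} · N for 0 < t < N, and N = −1 ≠ 0 in F_q because q = 0 there.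
-- The gap u_k = … = u_{N−2} = 0 thus makes α², …, α^{d−1} roots of U, so
-- U = g₁ h with deg h ≤ k. Dividing h by x − α gives h = (x − α) l + h(α), hence
-- U = h(α) g₁ + l g, and h(α) ≠ 0 because g₁(α) h(α) = U(α) = u_{N−1} · N ≠ 0.

module Submission where

open import Defs
open import Algebra.Bundles using (CommutativeRing; CommutativeMonoid; CommutativeSemiring)
open import Algebra.Structures.Biased using (isCommutativeMonoidˡ; isCommutativeSemiringˡ)
import Algebra.Properties.CommutativeSemigroup as CommutativeSemigroupProperties
open import Data.Empty using (⊥-elim)
open import Data.Fin as Fin using (Fin; toℕ)
import Data.Fin.Properties as FinP
open import Data.Fin.Permutation using (permutation)
open import Data.List using ([]; _∷_; length)
open import Data.Nat using (ℕ; zero; suc; _∸_; _≤_; _<_; z≤n; s≤s; NonZero) renaming (_+_ to _+ℕ_; _*_ to _*ℕ_)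
open import Data.Nat.DivMod using (_%_; _/_; m≡m%n+[m/n]*n; m%n<n)
import Data.Nat.Properties as ℕ
open import Data.Product using (Σ; _×_; _,_; proj₁; proj₂)
open import Relation.Nullary using (¬_)
open import Relation.Binary.Bundles using (Setoid)
open import Relation.Binary.Definitions using (tri<; tri≈; tri>)
open import Relation.Binary.Structures using (IsEquivalence)
open import Relation.Binary.PropositionalEquality as ≡ using (_≡_)
import Relation.Binary.Reasoning.Setoid as SetoidReasoning

module Polynomials {c ℓ} (R : CommutativeRing c ℓ) where
  open CommutativeRing R hiding (zero)
  open import Algebra.Properties.Ring ring using (-‿distribˡ-*)
  open CommutativeSemigroupProperties +-commutativeSemigroup using () renaming (interchange to +-interchange; x∙yz≈y∙xz to +-leftComm)
  open CommutativeSemigroupProperties *-commutativeSemigroup using () renaming (x∙yz≈y∙xz to *-leftComm)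
  open FF R

  -- p ≈P r unfolds to a Π-type, from which Agda cannot recover p and r;
  -- the record wrapper keeps them inferable.
  infix 4 _≋_
  record _≋_ (p r : Poly) : Set ℓ where
    constructor coeffwise
    field coeff-≈ : p ≈P r
  open _≋_ public

  ≋-isEquivalence : IsEquivalence _≋_
  ≋-isEquivalence = record
    { refl  = coeffwise λ _ → refl
    ; sym   = λ p≋r → coeffwise λ j → sym (coeff-≈ p≋r j)
    ; trans = λ p≋r r≋s → coeffwise λ j → trans (coeff-≈ p≋r j) (coeff-≈ r≋s j)
    }

  ≋-setoid : Setoid c ℓ
  ≋-setoid = record { isEquivalence = ≋-isEquivalence }

  open Setoid ≋-setoid public using () renaming (refl to ≋-refl; sym to ≋-sym; trans to ≋-trans)

  ∷-cong : ∀ {a b p r} → a ≈ b → p ≋ r → (a ∷ p) ≋ (b ∷ r)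
  ∷-cong a≈b p≋r = coeffwise λ { zero → a≈b ; (suc j) → coeff-≈ p≋r j }

  head-≈ : ∀ {a b p r} → (a ∷ p) ≋ (b ∷ r) → a ≈ b
  head-≈ e = coeff-≈ e zero

  tail-≋ : ∀ {a b p r} → (a ∷ p) ≋ (b ∷ r) → p ≋ r
  tail-≋ e = coeffwise λ j → coeff-≈ e (suc j)

  0∷[]≋[] : (0# ∷ []) ≋ []
  0∷[]≋[] = coeffwise λ { zero → refl ; (suc j) → refl }

  coeff-+P : ∀ p r j → coeff (p +P r) j ≈ coeff p j + coeff r j
  coeff-+P []      r       j       = sym (+-identityˡ _)
  coeff-+P (a ∷ p) []      j       = sym (+-identityʳ _)
  coeff-+P (a ∷ p) (b ∷ r) zero    = refl
  coeff-+P (a ∷ p) (b ∷ r) (suc j) = coeff-+P p r j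

  coeff-·P : ∀ a p j → coeff (a ·P p) j ≈ a * coeff p j
  coeff-·P a []      j       = sym (zeroʳ a)
  coeff-·P a (b ∷ p) zero    = refl
  coeff-·P a (b ∷ p) (suc j) = coeff-·P a p j

  +P-cong : ∀ {p p′ r r′} → p ≋ p′ → r ≋ r′ → (p +P r) ≋ (p′ +P r′)
  +P-cong {p} {p′} {r} {r′} p≋p′ r≋r′ = coeffwise λ j → begin
    coeff (p +P r) j       ≈⟨ coeff-+P p r j ⟩
    coeff p j + coeff r j   ≈⟨ +-cong (coeff-≈ p≋p′ j) (coeff-≈ r≋r′ j) ⟩
    coeff p′ j + coeff r′ j ≈⟨ coeff-+P p′ r′ j ⟨
    coeff (p′ +P r′) j     ∎
    where open SetoidReasoning setoid

  +P-assoc : ∀ p r s → ((p +P r) +P s) ≋ (p +P (r +P s))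
  +P-assoc p r s = coeffwise λ j → begin
    coeff ((p +P r) +P s) j             ≈⟨ trans (coeff-+P (p +P r) s j) (+-congʳ (coeff-+P p r j)) ⟩
    (coeff p j + coeff r j) + coeff s j ≈⟨ +-assoc _ _ _ ⟩
    coeff p j + (coeff r j + coeff s j) ≈⟨ trans (coeff-+P p (r +P s) j) (+-congˡ (coeff-+P r s j)) ⟨
    coeff (p +P (r +P s)) j             ∎
    where open SetoidReasoning setoid

  +P-comm : ∀ p r → (p +P r) ≋ (r +P p)
  +P-comm p r = coeffwise λ j → trans (coeff-+P p r j) (trans (+-comm _ _) (sym (coeff-+P r p j)))

  +P-commutativeMonoid : CommutativeMonoid c ℓ
  +P-commutativeMonoid = record
    { isCommutativeMonoid = isCommutativeMonoidˡ record
      { isSemigroup = record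
        { isMagma = record { isEquivalence = ≋-isEquivalence ; ∙-cong = +P-cong }
        ; assoc   = +P-assoc
        }
      ; identityˡ = λ _ → ≋-refl
      ; comm      = +P-comm
      }
    }

  open CommutativeSemigroupProperties (CommutativeMonoid.commutativeSemigroup +P-commutativeMonoid)
    using () renaming (interchange to +P-interchange; x∙yz≈y∙xz to +P-leftComm)

  +P-identityʳ : ∀ p → (p +P []) ≋ p
  +P-identityʳ = CommutativeMonoid.identityʳ +P-commutativeMonoid

  ·P-cong : ∀ {a b p r} → a ≈ b → p ≋ r → (a ·P p) ≋ (b ·P r)
  ·P-cong {a} {b} {p} {r} a≈b p≋r = coeffwise λ j →
    trans (coeff-·P a p j) (trans (*-cong a≈b (coeff-≈ p≋r j)) (sym (coeff-·P b r j)))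

  ·P-distribˡ : ∀ a p r → (a ·P (p +P r)) ≋ ((a ·P p) +P (a ·P r))
  ·P-distribˡ a p r = coeffwise λ j → begin
    coeff (a ·P (p +P r)) j             ≈⟨ trans (coeff-·P a (p +P r) j) (*-congˡ (coeff-+P p r j)) ⟩
    a * (coeff p j + coeff r j)         ≈⟨ distribˡ _ _ _ ⟩
    a * coeff p j + a * coeff r j       ≈⟨ trans (coeff-+P (a ·P p) (a ·P r) j) (+-cong (coeff-·P a p j) (coeff-·P a r j)) ⟨
    coeff ((a ·P p) +P (a ·P r)) j      ∎
    where open SetoidReasoning setoid

  ·P-distribʳ : ∀ a b p → ((a + b) ·P p) ≋ ((a ·P p) +P (b ·P p))
  ·P-distribʳ a b p = coeffwise λ j → begin
    coeff ((a + b) ·P p) j           ≈⟨ coeff-·P (a + b) p j ⟩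
    (a + b) * coeff p j              ≈⟨ distribʳ _ _ _ ⟩
    a * coeff p j + b * coeff p j    ≈⟨ trans (coeff-+P (a ·P p) (b ·P p) j) (+-cong (coeff-·P a p j) (coeff-·P b p j)) ⟨
    coeff ((a ·P p) +P (b ·P p)) j   ∎
    where open SetoidReasoning setoid

  ·P-assoc : ∀ a b p → (a ·P (b ·P p)) ≋ ((a * b) ·P p)
  ·P-assoc a b p = coeffwise λ j →
    trans (trans (coeff-·P a (b ·P p) j) (*-congˡ (coeff-·P b p j)))
          (trans (sym (*-assoc _ _ _)) (sym (coeff-·P (a * b) p j)))

  ·P-zeroˡ : ∀ p → (0# ·P p) ≋ []
  ·P-zeroˡ p = coeffwise λ j → trans (coeff-·P 0# p j) (zeroˡ _)

  ·P-identityˡ : ∀ p → (1# ·P p) ≋ p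
  ·P-identityˡ p = coeffwise λ j → trans (coeff-·P 1# p j) (*-identityˡ _)

  *P-zeroʳ : ∀ p → (p *P []) ≋ []
  *P-zeroʳ []      = ≋-refl
  *P-zeroʳ (a ∷ p) = ≋-trans (∷-cong refl (*P-zeroʳ p)) 0∷[]≋[]

  *P-∷ : ∀ p a r → (p *P (a ∷ r)) ≋ ((a ·P p) +P (0# ∷ (p *P r)))
  *P-∷ []      a r = ≋-sym 0∷[]≋[]
  *P-∷ (b ∷ p) a r = ∷-cong (+-congʳ (*-comm b a)) (begin
    (b ·P r) +P (p *P (a ∷ r))                    ≈⟨ +P-cong ≋-refl (*P-∷ p a r) ⟩
    (b ·P r) +P ((a ·P p) +P (0# ∷ (p *P r)))     ≈⟨ +P-leftComm (b ·P r) (a ·P p) (0# ∷ (p *P r)) ⟩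
    (a ·P p) +P ((b ·P r) +P (0# ∷ (p *P r)))     ∎)
    where open SetoidReasoning ≋-setoid

  *P-comm : ∀ p r → (p *P r) ≋ (r *P p)
  *P-comm []      r = ≋-sym (*P-zeroʳ r)
  *P-comm (a ∷ p) r = ≋-trans (+P-cong ≋-refl (∷-cong refl (*P-comm p r))) (≋-sym (*P-∷ r a p))

  *P-congʳ : ∀ p {r r′} → r ≋ r′ → (p *P r) ≋ (p *P r′)
  *P-congʳ []      r≋r′ = ≋-refl
  *P-congʳ (a ∷ p) r≋r′ = +P-cong (·P-cong refl r≋r′) (∷-cong refl (*P-congʳ p r≋r′))

  *P-cong : ∀ {p p′ r r′} → p ≋ p′ → r ≋ r′ → (p *P r) ≋ (p′ *P r′)
  *P-cong {p} {p′} {r} {r′} p≋p′ r≋r′ =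
    ≋-trans (*P-comm p r) (≋-trans (*P-congʳ r p≋p′) (≋-trans (*P-comm r p′) (*P-congʳ p′ r≋r′)))

  *P-distribʳ : ∀ r p p′ → ((p +P p′) *P r) ≋ ((p *P r) +P (p′ *P r))
  *P-distribʳ r []      p′       = ≋-refl
  *P-distribʳ r (a ∷ p) []       = ≋-sym (+P-identityʳ ((a ∷ p) *P r))
  *P-distribʳ r (a ∷ p) (b ∷ p′) = begin
    ((a + b) ·P r) +P (0# ∷ ((p +P p′) *P r))
      ≈⟨ +P-cong (·P-distribʳ a b r) (∷-cong (sym (+-identityˡ 0#)) (*P-distribʳ r p p′)) ⟩
    ((a ·P r) +P (b ·P r)) +P ((0# ∷ (p *P r)) +P (0# ∷ (p′ *P r)))
      ≈⟨ +P-interchange (a ·P r) (b ·P r) (0# ∷ (p *P r)) (0# ∷ (p′ *P r)) ⟩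
    ((a ·P r) +P (0# ∷ (p *P r))) +P ((b ·P r) +P (0# ∷ (p′ *P r))) ∎
    where open SetoidReasoning ≋-setoid

  ·P-*P : ∀ a p r → ((a ·P p) *P r) ≋ (a ·P (p *P r))
  ·P-*P a []      r = ≋-refl
  ·P-*P a (b ∷ p) r = begin
    ((a * b) ·P r) +P (0# ∷ ((a ·P p) *P r))   ≈⟨ +P-cong (≋-sym (·P-assoc a b r)) (∷-cong (sym (zeroʳ a)) (·P-*P a p r)) ⟩
    (a ·P (b ·P r)) +P (a ·P (0# ∷ (p *P r)))  ≈⟨ ·P-distribˡ a (b ·P r) (0# ∷ (p *P r)) ⟨
    a ·P ((b ·P r) +P (0# ∷ (p *P r)))         ∎
    where open SetoidReasoning ≋-setoid

  0∷-*P : ∀ p r → ((0# ∷ p) *P r) ≋ (0# ∷ (p *P r))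
  0∷-*P p r = +P-cong (·P-zeroˡ r) ≋-refl

  *P-assoc : ∀ p r s → ((p *P r) *P s) ≋ (p *P (r *P s))
  *P-assoc []      r s = ≋-refl
  *P-assoc (a ∷ p) r s = begin
    ((a ·P r) +P (0# ∷ (p *P r))) *P s          ≈⟨ *P-distribʳ s (a ·P r) (0# ∷ (p *P r)) ⟩
    ((a ·P r) *P s) +P ((0# ∷ (p *P r)) *P s)  ≈⟨ +P-cong (·P-*P a r s) (≋-trans (0∷-*P (p *P r) s) (∷-cong refl (*P-assoc p r s))) ⟩
    (a ·P (r *P s)) +P (0# ∷ (p *P (r *P s)))  ∎
    where open SetoidReasoning ≋-setoid

  *P-identityˡ : ∀ p → ((1# ∷ []) *P p) ≋ p
  *P-identityˡ p = ≋-trans (+P-cong (·P-identityˡ p) 0∷[]≋[]) (+P-identityʳ p)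

  ·P≋const-*P : ∀ a p → (a ·P p) ≋ ((a ∷ []) *P p)
  ·P≋const-*P a p = ≋-sym (≋-trans (+P-cong ≋-refl 0∷[]≋[]) (+P-identityʳ (a ·P p)))

  Poly-commutativeSemiring : CommutativeSemiring c ℓ
  Poly-commutativeSemiring = record
    { _+_ = _+P_ ; _*_ = _*P_ ; 0# = [] ; 1# = 1# ∷ []
    ; isCommutativeSemiring = isCommutativeSemiringˡ record
      { +-isCommutativeMonoid = CommutativeMonoid.isCommutativeMonoid +P-commutativeMonoid
      ; *-isCommutativeMonoid = isCommutativeMonoidˡ record
        { isSemigroup = record
          { isMagma = record { isEquivalence = ≋-isEquivalence ; ∙-cong = *P-cong }
          ; assoc   = *P-assoc
          }
        ; identityˡ = *P-identityˡ
        ; comm      = *P-comm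
        }
      ; distribʳ = *P-distribʳ
      ; zeroˡ    = λ _ → ≋-refl
      }
    }

  length-fromFun : ∀ n (f : Fin n → Carrier) → length (fromFun n f) ≡ n
  length-fromFun zero    f = ≡.refl
  length-fromFun (suc n) f = ≡.cong suc (length-fromFun n (λ j → f (Fin.suc j)))

  fromFun-coeff : ∀ p → fromFun (length p) (λ j → coeff p (toℕ j)) ≡ p
  fromFun-coeff []      = ≡.refl
  fromFun-coeff (a ∷ p) = ≡.cong (a ∷_) (fromFun-coeff p)

  eval : Poly → Carrier → Carrier
  eval []      x = 0#
  eval (a ∷ p) x = a + x * eval p x

  eval-≋[] : ∀ {p} x → p ≋ [] → eval p x ≈ 0#
  eval-≋[] {[]}    x p≋[] = refl
  eval-≋[] {a ∷ p} x p≋[] =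
    trans (+-cong (coeff-≈ p≋[] zero) (*-congˡ (eval-≋[] {p} x (coeffwise λ j → coeff-≈ p≋[] (suc j)))))
          (trans (+-identityˡ _) (zeroʳ x))

  eval-cong : ∀ {p r} x → p ≋ r → eval p x ≈ eval r x
  eval-cong {[]}    x p≋r = sym (eval-≋[] x (≋-sym p≋r))
  eval-cong {a ∷ p} {[]}    x p≋r = eval-≋[] x p≋r
  eval-cong {a ∷ p} {b ∷ r} x p≋r = +-cong (head-≈ p≋r) (*-congˡ (eval-cong x (tail-≋ p≋r)))

  eval-+P : ∀ p r x → eval (p +P r) x ≈ eval p x + eval r x
  eval-+P []      r       x = sym (+-identityˡ _)
  eval-+P (a ∷ p) []      x = sym (+-identityʳ _)
  eval-+P (a ∷ p) (b ∷ r) x = begin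
    (a + b) + x * eval (p +P r) x        ≈⟨ +-congˡ (*-congˡ (eval-+P p r x)) ⟩
    (a + b) + x * (eval p x + eval r x)  ≈⟨ +-congˡ (distribˡ x (eval p x) (eval r x)) ⟩
    (a + b) + (x * eval p x + x * eval r x) ≈⟨ +-interchange a b (x * eval p x) (x * eval r x) ⟩
    (a + x * eval p x) + (b + x * eval r x) ∎
    where open SetoidReasoning setoid

  eval-·P : ∀ a p x → eval (a ·P p) x ≈ a * eval p x
  eval-·P a []      x = sym (zeroʳ a)
  eval-·P a (b ∷ p) x = begin
    a * b + x * eval (a ·P p) x  ≈⟨ +-congˡ (*-congˡ (eval-·P a p x)) ⟩
    a * b + x * (a * eval p x)   ≈⟨ +-congˡ (*-leftComm x a (eval p x)) ⟩
    a * b + a * (x * eval p x)   ≈⟨ distribˡ a b (x * eval p x) ⟨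
    a * (b + x * eval p x)       ∎
    where open SetoidReasoning setoid

  eval-*P : ∀ p r x → eval (p *P r) x ≈ eval p x * eval r x
  eval-*P []      r x = sym (zeroˡ _)
  eval-*P (a ∷ p) r x = begin
    eval ((a ·P r) +P (0# ∷ (p *P r))) x           ≈⟨ eval-+P (a ·P r) (0# ∷ (p *P r)) x ⟩
    eval (a ·P r) x + (0# + x * eval (p *P r) x)   ≈⟨ +-cong (eval-·P a r x) (trans (+-identityˡ _) (*-congˡ (eval-*P p r x))) ⟩
    a * eval r x + x * (eval p x * eval r x)       ≈⟨ +-congˡ (*-assoc x (eval p x) (eval r x)) ⟨
    a * eval r x + (x * eval p x) * eval r x       ≈⟨ distribʳ (eval r x) a (x * eval p x) ⟨
    (a + x * eval p x) * eval r x                  ∎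
    where open SetoidReasoning setoid

  eval-xMinus : ∀ b x → eval (xMinus b) x ≈ x - b
  eval-xMinus b x = begin
    - b + x * (1# + x * 0#) ≈⟨ +-congˡ (*-congˡ (trans (+-congˡ (zeroʳ x)) (+-identityʳ 1#))) ⟩
    - b + x * 1#            ≈⟨ trans (+-congˡ (*-identityʳ x)) (+-comm _ _) ⟩
    x - b                   ∎
    where open SetoidReasoning setoid

  -- Synthetic division by x − b: coefficient j of the quotient is the tail of p
  -- beyond index j, evaluated at b.
  quot : Carrier → Poly → Poly
  quot b []          = []
  quot b (a ∷ [])    = []
  quot b (a ∷ a′ ∷ p) = eval (a′ ∷ p) b ∷ quot b (a′ ∷ p)

  length-quot : ∀ b p → length (quot b p) ≡ length p ∸ 1
  length-quot b []           = ≡.refl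
  length-quot b (a ∷ [])     = ≡.refl
  length-quot b (a ∷ a′ ∷ p) = ≡.cong suc (length-quot b (a′ ∷ p))

  xMinus-*P : ∀ b q → (xMinus b *P q) ≋ (((- b) ·P q) +P (0# ∷ q))
  xMinus-*P b q = +P-cong ≋-refl (∷-cong refl (*P-identityˡ q))

  quot-remainder : ∀ b p → p ≋ ((xMinus b *P quot b p) +P (eval p b ∷ []))
  quot-remainder b []           = ≋-sym (≋-trans (+P-cong (*P-zeroʳ (xMinus b)) ≋-refl) 0∷[]≋[])
  quot-remainder b (a ∷ [])     =
    ≋-sym (≋-trans (+P-cong (*P-zeroʳ (xMinus b)) ≋-refl) (∷-cong (trans (+-congˡ (zeroʳ b)) (+-identityʳ a)) ≋-refl))
  quot-remainder b (a ∷ a′ ∷ p) = ≋-sym (begin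
    (xMinus b *P (e ∷ q)) +P ((a + b * e) ∷ [])
      ≈⟨ +P-cong (xMinus-*P b (e ∷ q)) (≋-refl {(a + b * e) ∷ []}) ⟩
    ((- b * e + 0#) + (a + b * e)) ∷ ((((- b) ·P q) +P (e ∷ q)) +P [])
      ≈⟨ ∷-cong head (tail (quot-remainder b (a′ ∷ p))) ⟩
    a ∷ a′ ∷ p ∎)
    where
    open SetoidReasoning ≋-setoid
    e = eval (a′ ∷ p) b
    q = quot b (a′ ∷ p)
    head : (- b * e + 0#) + (a + b * e) ≈ a
    head = trans (+-congʳ (trans (+-identityʳ _) (sym (-‿distribˡ-* b e))))
           (trans (+-leftComm (- (b * e)) a (b * e))
                  (trans (+-congˡ (-‿inverseˡ _)) (+-identityʳ a)))
    tail : (a′ ∷ p) ≋ ((xMinus b *P q) +P (e ∷ [])) → ((((- b) ·P q) +P (e ∷ q)) +P []) ≋ (a′ ∷ p)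
    tail ih = begin
      (((- b) ·P q) +P (e ∷ q)) +P []           ≈⟨ +P-identityʳ _ ⟩
      ((- b) ·P q) +P (e ∷ q)                   ≈⟨ +P-cong ≋-refl (∷-cong (sym (+-identityˡ e)) (≋-sym (+P-identityʳ q))) ⟩
      ((- b) ·P q) +P ((0# ∷ q) +P (e ∷ []))    ≈⟨ +P-assoc ((- b) ·P q) (0# ∷ q) (e ∷ []) ⟨
      (((- b) ·P q) +P (0# ∷ q)) +P (e ∷ [])    ≈⟨ +P-cong (xMinus-*P b q) ≋-refl ⟨
      (xMinus b *P q) +P (e ∷ [])               ≈⟨ ih ⟨
      a′ ∷ p                                    ∎

  factor-root : ∀ b p → eval p b ≈ 0# → p ≋ (xMinus b *P quot b p)
  factor-root b p pb≈0 =
    ≋-trans (quot-remainder b p) (≋-trans (+P-cong ≋-refl (≋-trans (∷-cong pb≈0 ≋-refl) 0∷[]≋[])) (+P-identityʳ _))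

  cofactor-split : ∀ b g h k → length h ≡ suc k → Σ (Fin k → Carrier) λ l →
                   ((eval h b ·P g) +P (fromFun k l *P (xMinus b *P g))) ≋ (g *P h)
  cofactor-split b g h k length-h = l , (begin
    (a ·P g) +P (fromFun k l *P (X *P g))      ≡⟨ ≡.cong (λ p → (a ·P g) +P (p *P (X *P g))) l≡q ⟩
    (a ·P g) +P (q *P (X *P g))                ≈⟨ +P-cong (·P≋const-*P a g) ≋-refl ⟩
    ((a ∷ []) *P g) +P (q *P (X *P g))         ≈⟨ solve 4 (λ A G Q Y → A :* G :+ Q :* (Y :* G) := G :* (Y :* Q :+ A))
                                                         ≋-refl (a ∷ []) g q X ⟩
    g *P ((X *P q) +P (a ∷ []))                ≈⟨ *P-congʳ g (quot-remainder b h) ⟨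
    g *P h                                     ∎)
    where
    open SetoidReasoning ≋-setoid
    open import Algebra.Solver.Ring.NaturalCoefficients.Default Poly-commutativeSemiring using (solve; _:+_; _:*_; _:=_)
    a = eval h b
    X = xMinus b
    q = quot b h
    l : Fin k → Carrier
    l j = coeff q (toℕ j)
    l≡q : fromFun k l ≡ q
    l≡q = ≡.subst (λ m → fromFun m (λ j → coeff q (toℕ j)) ≡ q)
                  (≡.trans (length-quot b h) (≡.cong (_∸ 1) length-h)) (fromFun-coeff q)

module PowersAndSums {c ℓ} (R : CommutativeRing c ℓ) where
  open CommutativeRing R hiding (zero)
  open FF R
  open Polynomials R
  open import Algebra.Properties.CommutativeSemiring.Exp commutativeSemiring using (_^_; ^-homo-*; ^-assocʳ; ^-distrib-*; ^-congˡ)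
  open import Algebra.Properties.Monoid.Mult +-monoid using () renaming (_×_ to _·_)
  open import Algebra.Properties.Semiring.Sum semiring using (sum; sum-syntax; sum-cong-≋; sum-replicate; sum-replicate-zero; *-distribˡ-sum)
  open import Algebra.Solver.Ring.NaturalCoefficients.Default commutativeSemiring
  open CommutativeSemigroupProperties *-commutativeSemigroup using () renaming (x∙yz≈y∙xz to *-leftComm)

  pow≡^ : ∀ x n → pow x n ≡ x ^ n
  pow≡^ x zero    = ≡.refl
  pow≡^ x (suc n) = ≡.cong (x *_) (pow≡^ x n)

  pow-+ : ∀ x m n → pow x (m +ℕ n) ≈ pow x m * pow x n
  pow-+ x m n rewrite pow≡^ x (m +ℕ n) | pow≡^ x m | pow≡^ x n = ^-homo-* x m n

  pow-* : ∀ x m n → pow x (m *ℕ n) ≈ pow (pow x m) n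
  pow-* x m n rewrite pow≡^ x (m *ℕ n) | pow≡^ x m | pow≡^ (x ^ m) n = sym (^-assocʳ x m n)

  pow-distrib-* : ∀ x y n → pow (x * y) n ≈ pow x n * pow y n
  pow-distrib-* x y n rewrite pow≡^ (x * y) n | pow≡^ x n | pow≡^ y n = ^-distrib-* x y n

  pow-+-∸ : ∀ x {i j} → i ≤ j → pow x i * pow x (j ∸ i) ≈ pow x j
  pow-+-∸ x {i} {j} i≤j = trans (sym (pow-+ x i (j ∸ i))) (reflexive (≡.cong (pow x) (ℕ.m+[n∸m]≡n i≤j)))

  pow-congˡ : ∀ {x y} n → x ≈ y → pow x n ≈ pow y n
  pow-congˡ {x} {y} n x≈y rewrite pow≡^ x n | pow≡^ y n = ^-congˡ n x≈y

  pow-1# : ∀ n → pow 1# n ≈ 1#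
  pow-1# zero    = refl
  pow-1# (suc n) = trans (*-identityˡ _) (pow-1# n)

  pow-multiple-≈1 : ∀ x n s → pow x n ≈ 1# → pow x (n *ℕ s) ≈ 1#
  pow-multiple-≈1 x n s xⁿ≈1 = trans (pow-* x n s) (trans (pow-congˡ s xⁿ≈1) (pow-1# s))

  pow-% : ∀ x m i .{{_ : NonZero m}} → pow x m ≈ 1# → pow x i ≈ pow x (i % m)
  pow-% x m i xᵐ≈1 = begin
    pow x i                                 ≡⟨ ≡.cong (pow x) (m≡m%n+[m/n]*n i m) ⟩
    pow x (i % m +ℕ (i / m) *ℕ m)           ≈⟨ pow-+ x (i % m) ((i / m) *ℕ m) ⟩
    pow x (i % m) * pow x ((i / m) *ℕ m)    ≈⟨ *-congˡ (trans (reflexive (≡.cong (pow x) (ℕ.*-comm (i / m) m)))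
                                                                (pow-multiple-≈1 x m (i / m) xᵐ≈1)) ⟩
    pow x (i % m) * 1#                      ≈⟨ *-identityʳ _ ⟩
    pow x (i % m)                           ∎
    where open SetoidReasoning setoid

  sumF≡sum : ∀ n (f : Fin n → Carrier) → sumF n f ≡ sum f
  sumF≡sum zero    f = ≡.refl
  sumF≡sum (suc n) f = ≡.cong (f Fin.zero +_) (sumF≡sum n (λ i → f (Fin.suc i)))

  eval-fromFun : ∀ n (f : Fin n → Carrier) x → eval (fromFun n f) x ≈ ∑[ j < n ] (f j * pow x (toℕ j))
  eval-fromFun zero    f x = refl
  eval-fromFun (suc n) f x = +-cong (sym (*-identityʳ _)) (begin
    x * eval (fromFun n (λ j → f (Fin.suc j))) x            ≈⟨ *-congˡ (eval-fromFun n (λ j → f (Fin.suc j)) x) ⟩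
    x * ∑[ j < n ] (f (Fin.suc j) * pow x (toℕ j))           ≈⟨ *-distribˡ-sum {n} x (λ j → f (Fin.suc j) * pow x (toℕ j)) ⟩
    ∑[ j < n ] (x * (f (Fin.suc j) * pow x (toℕ j)))         ≈⟨ sum-cong-≋ {n} (λ j → *-leftComm x _ _) ⟩
    ∑[ j < n ] (f (Fin.suc j) * (x * pow x (toℕ j)))         ∎)
    where open SetoidReasoning setoid

  sum-select : ∀ n (g h : Fin n → Carrier) m y →
               (∀ i → toℕ i ≡ m → h i ≈ y) → (∀ i → ¬ toℕ i ≡ m → h i ≈ 0#) →
               ∑[ i < n ] (g i * h i) ≈ coeff (fromFun n g) m * y
  sum-select zero    g h m       y hit miss = sym (zeroˡ y)
  sum-select (suc n) g h zero    y hit miss =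
    trans (+-cong (*-congˡ (hit Fin.zero ≡.refl))
                  (trans (sum-cong-≋ {n} (λ i → trans (*-congˡ (miss (Fin.suc i) λ ())) (zeroʳ _)))
                         (sum-replicate-zero n)))
          (+-identityʳ _)
  sum-select (suc n) g h (suc m) y hit miss =
    trans (+-cong (trans (*-congˡ (miss Fin.zero λ ())) (zeroʳ _))
                  (sum-select n (λ i → g (Fin.suc i)) (λ i → h (Fin.suc i)) m y
                              (λ i eq → hit (Fin.suc i) (≡.cong suc eq))
                              (λ i ne → miss (Fin.suc i) (λ eq → ne (ℕ.suc-injective eq)))))
          (+-identityˡ _)

  powerSum : ℕ → Carrier → Carrier
  powerSum n y = ∑[ j < n ] pow y (toℕ j)

  powerSum-suc : ∀ n y → powerSum (suc n) y ≈ 1# + y * powerSum n y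
  powerSum-suc n y = +-congˡ (sym (*-distribˡ-sum {n} y (λ j → pow y (toℕ j))))

  powerSum-geometric : ∀ n y → y * powerSum n y + 1# ≈ powerSum n y + pow y n
  powerSum-geometric zero    y = +-congʳ (zeroʳ y)
  powerSum-geometric (suc n) y = begin
    y * powerSum (suc n) y + 1#   ≈⟨ +-congʳ (*-congˡ (powerSum-suc n y)) ⟩
    y * (1# + y * s) + 1#         ≈⟨ solve 2 (λ y s → y :* (con 1 :+ y :* s) :+ con 1 := y :* (y :* s :+ con 1) :+ con 1) refl y s ⟩
    y * (y * s + 1#) + 1#         ≈⟨ +-congʳ (*-congˡ (powerSum-geometric n y)) ⟩
    y * (s + pow y n) + 1#        ≈⟨ solve 3 (λ y s t → y :* (s :+ t) :+ con 1 := (con 1 :+ y :* s) :+ y :* t) refl y s (pow y n) ⟩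
    (1# + y * s) + y * pow y n    ≈⟨ +-congʳ (powerSum-suc n y) ⟨
    powerSum (suc n) y + pow y (suc n) ∎
    where
    open SetoidReasoning setoid
    s = powerSum n y

  powerSum-1# : ∀ n {y} → y ≈ 1# → powerSum n y ≈ n · 1#
  powerSum-1# n y≈1 = trans (sum-cong-≋ {n} (λ j → trans (pow-congˡ (toℕ j) y≈1) (pow-1# (toℕ j)))) (sum-replicate n)

module FieldLemmas {c ℓ} (R : CommutativeRing c ℓ) (isField : FF.IsField R) where
  open CommutativeRing R hiding (zero)
  open import Algebra.Properties.Ring ring using (x∙y⁻¹≈ε⇒x≈y; x≈y⇒x∙y⁻¹≈ε; x[y-z]≈xy-xz; [y-z]x≈yx-zx; +-cancelʳ)
  open FF R
  open Polynomials R
  open PowersAndSums R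

  x*y≈0⇒y≈0 : ∀ {x y} → ¬ x ≈ 0# → x * y ≈ 0# → y ≈ 0#
  x*y≈0⇒y≈0 {x} {y} x≉0 xy≈0 with proj₂ isField x x≉0
  ... | x⁻¹ , xx⁻¹≈1 = begin
    y              ≈⟨ *-identityˡ y ⟨
    1# * y         ≈⟨ *-congʳ (trans (sym xx⁻¹≈1) (*-comm x x⁻¹)) ⟩
    (x⁻¹ * x) * y  ≈⟨ *-assoc x⁻¹ x y ⟩
    x⁻¹ * (x * y)  ≈⟨ *-congˡ xy≈0 ⟩
    x⁻¹ * 0#       ≈⟨ zeroʳ x⁻¹ ⟩
    0#             ∎
    where open SetoidReasoning setoid

  *-≉0 : ∀ {x y} → ¬ x ≈ 0# → ¬ y ≈ 0# → ¬ x * y ≈ 0#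
  *-≉0 x≉0 y≉0 xy≈0 = y≉0 (x*y≈0⇒y≈0 x≉0 xy≈0)

  pow-≉0 : ∀ {x} n → ¬ x ≈ 0# → ¬ pow x n ≈ 0#
  pow-≉0 zero    x≉0 = proj₁ isField
  pow-≉0 (suc n) x≉0 = *-≉0 x≉0 (pow-≉0 n x≉0)

  pow-cancel : ∀ {x} i j → ¬ x ≈ 0# → i ≤ j → pow x i ≈ pow x j → pow x (j ∸ i) ≈ 1#
  pow-cancel {x} i j x≉0 i≤j xⁱ≈xʲ = x∙y⁻¹≈ε⇒x≈y _ _ (x*y≈0⇒y≈0 (pow-≉0 i x≉0) (begin
    pow x i * (pow x (j ∸ i) - 1#)           ≈⟨ x[y-z]≈xy-xz _ _ _ ⟩
    pow x i * pow x (j ∸ i) - pow x i * 1#   ≈⟨ +-cong (pow-+-∸ x i≤j) (-‿cong (*-identityʳ _)) ⟩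
    pow x j - pow x i                        ≈⟨ x≈y⇒x∙y⁻¹≈ε (sym xⁱ≈xʲ) ⟩
    0#                                       ∎))
    where open SetoidReasoning setoid

  powerSum-vanishes : ∀ n {y} → pow y n ≈ 1# → ¬ y ≈ 1# → powerSum n y ≈ 0#
  powerSum-vanishes n {y} yⁿ≈1 y≉1 = x*y≈0⇒y≈0 (λ y-1≈0 → y≉1 (x∙y⁻¹≈ε⇒x≈y y 1# y-1≈0)) (begin
    (y - 1#) * s     ≈⟨ [y-z]x≈yx-zx s y 1# ⟩
    y * s - 1# * s   ≈⟨ x≈y⇒x∙y⁻¹≈ε (trans y*s≈s (sym (*-identityˡ s))) ⟩
    0#               ∎)
    where
    open SetoidReasoning setoid
    s = powerSum n y
    y*s≈s : y * s ≈ s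
    y*s≈s = +-cancelʳ 1# (y * s) s (trans (powerSum-geometric n y) (+-congˡ yⁿ≈1))

  quot-root : ∀ b p {x} → eval p b ≈ 0# → eval p x ≈ 0# → ¬ x ≈ b → eval (quot b p) x ≈ 0#
  quot-root b p {x} pb≈0 px≈0 x≉b = x*y≈0⇒y≈0 (λ x-b≈0 → x≉b (x∙y⁻¹≈ε⇒x≈y x b x-b≈0)) (begin
    (x - b) * eval (quot b p) x               ≈⟨ *-congʳ (eval-xMinus b x) ⟨
    eval (xMinus b) x * eval (quot b p) x     ≈⟨ eval-*P (xMinus b) (quot b p) x ⟨
    eval (xMinus b *P quot b p) x             ≈⟨ eval-cong x (factor-root b p pb≈0) ⟨
    eval p x                                  ≈⟨ px≈0 ⟩
    0#                                        ∎)
    where open SetoidReasoning setoid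

  factor-powers : ∀ α B → (∀ i j → i < j → j < B → ¬ pow α i ≈ pow α j) →
                  ∀ n m p → m +ℕ n ≤ B → (∀ i → i < n → eval p (pow α (m +ℕ i)) ≈ 0#) →
                  Σ Poly λ h → p ≋ (prodRoots α m n *P h) × length h ≡ length p ∸ n
  factor-powers α B distinct zero    m p m+n≤B roots = p , ≋-sym (*P-identityˡ p) , ≡.refl
  factor-powers α B distinct (suc n) m p m+n≤B roots = h , p≋X*R*h , length-h
    where
    b = pow α m
    pb≈0 : eval p b ≈ 0#
    pb≈0 = ≡.subst (λ k → eval p (pow α k) ≈ 0#) (ℕ.+-identityʳ m) (roots 0 (s≤s z≤n))
    q = quot b p
    1+m+n≤B : suc m +ℕ n ≤ B
    1+m+n≤B = ≡.subst (_≤ B) (ℕ.+-suc m n) m+n≤B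
    q-roots : ∀ i → i < n → eval q (pow α (suc m +ℕ i)) ≈ 0#
    q-roots i i<n = quot-root b p pb≈0
      (≡.subst (λ k → eval p (pow α k) ≈ 0#) (ℕ.+-suc m i) (roots (suc i) (s≤s i<n)))
      (λ αᵐ⁺ⁱ⁺¹≈αᵐ → distinct m (suc m +ℕ i) (s≤s (ℕ.m≤m+n m i))
                       (ℕ.<-≤-trans (ℕ.+-monoʳ-< (suc m) i<n) 1+m+n≤B) (sym αᵐ⁺ⁱ⁺¹≈αᵐ))
    rest = factor-powers α B distinct n (suc m) q 1+m+n≤B q-roots
    h = proj₁ rest
    p≋X*R*h : p ≋ (prodRoots α m (suc n) *P h)
    p≋X*R*h = ≋-trans (factor-root b p pb≈0)
                (≋-trans (*P-congʳ (xMinus b) (proj₁ (proj₂ rest))) (≋-sym (*P-assoc (xMinus b) (prodRoots α (suc m) n) h)))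
    length-h : length h ≡ length p ∸ suc n
    length-h = ≡.trans (proj₂ (proj₂ rest)) (≡.trans (≡.cong (_∸ n) (length-quot b p)) (ℕ.∸-+-assoc (length p) 1 n))

module FiniteField {c ℓ} (R : CommutativeRing c ℓ) (isField : FF.IsField R) (N : ℕ) (size : FF.HasSize R (suc N)) where
  open CommutativeRing R hiding (zero)
  open import Algebra.Properties.Ring ring using (+-identityʳ-unique)
  open import Algebra.Properties.Monoid.Mult +-monoid using () renaming (_×_ to _·_)
  open import Algebra.Properties.Semiring.Sum semiring using (sum; sum-syntax; sum-cong-≋; sum-replicate; sum-permute; ∑-distrib-+)
  open FF R

  private
    enum : Fin (suc N) → Carrier
    enum = proj₁ size

    index : Carrier → Fin (suc N)
    index x = proj₁ (proj₁ (proj₂ size) x)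

    enum-index : ∀ x → enum (index x) ≈ x
    enum-index x = proj₂ (proj₁ (proj₂ size) x)

    enum-injective : ∀ i j → enum i ≈ enum j → i ≡ j
    enum-injective = proj₂ (proj₂ size)

  nonzeroAt : Fin N → Carrier
  nonzeroAt j = enum (Fin.punchIn (index 0#) j)

  nonzeroAt-≉0 : ∀ j → ¬ nonzeroAt j ≈ 0#
  nonzeroAt-≉0 j eq = FinP.punchInᵢ≢i (index 0#) j (enum-injective _ _ (trans eq (sym (enum-index 0#))))

  nonzeroAt-injective : ∀ i j → nonzeroAt i ≈ nonzeroAt j → i ≡ j
  nonzeroAt-injective i j eq = FinP.punchIn-injective (index 0#) i j (enum-injective _ _ eq)

  nonzeroIndex : ∀ x → ¬ x ≈ 0# → Fin N
  nonzeroIndex x x≉0 = Fin.punchOut {i = index 0#} {j = index x} λ eq →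
    x≉0 (trans (sym (enum-index x)) (trans (reflexive (≡.cong enum (≡.sym eq))) (enum-index 0#)))

  nonzeroAt-nonzeroIndex : ∀ x (x≉0 : ¬ x ≈ 0#) → nonzeroAt (nonzeroIndex x x≉0) ≈ x
  nonzeroAt-nonzeroIndex x x≉0 = trans (reflexive (≡.cong enum (FinP.punchIn-punchOut _))) (enum-index x)

  covering-bound : ∀ m (f : Fin m → Carrier) → (∀ x → ¬ x ≈ 0# → Σ (Fin m) λ i → x ≈ f i) → N ≤ m
  covering-bound m f cover = FinP.injective⇒≤ {f = position} λ {i} {j} eq →
    nonzeroAt-injective i j (trans (proj₂ (covered i)) (trans (reflexive (≡.cong f eq)) (sym (proj₂ (covered j)))))
    where
    covered : ∀ j → Σ (Fin m) λ i → nonzeroAt j ≈ f i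
    covered j = cover (nonzeroAt j) (nonzeroAt-≉0 j)
    position : Fin N → Fin m
    position j = proj₁ (covered j)

  size·1≈0 : suc N · 1# ≈ 0#
  size·1≈0 = +-identityʳ-unique (sum enum) (suc N · 1#) (sym (begin
    sum enum                            ≈⟨ sum-permute enum (permutation shift unshift unshift-shift shift-unshift) ⟩
    ∑[ i < suc N ] enum (shift i)       ≈⟨ sum-cong-≋ {suc N} (λ i → enum-index (enum i + 1#)) ⟩
    ∑[ i < suc N ] (enum i + 1#)        ≈⟨ ∑-distrib-+ enum (λ _ → 1#) ⟩
    sum enum + ∑[ i < suc N ] 1#        ≈⟨ +-congˡ (sum-replicate (suc N)) ⟩
    sum enum + suc N · 1#               ∎))
    where
    open SetoidReasoning setoid
    shift unshift : Fin (suc N) → Fin (suc N)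
    shift i = index (enum i + 1#)
    unshift i = index (enum i - 1#)
    unshift-shift : ∀ i → shift (unshift i) ≡ i
    unshift-shift i = enum-injective _ _ (trans (enum-index _) (trans (+-congʳ (enum-index _))
                        (trans (+-assoc _ _ _) (trans (+-congˡ (-‿inverseˡ 1#)) (+-identityʳ _)))))
    shift-unshift : ∀ i → unshift (shift i) ≡ i
    shift-unshift i = enum-injective _ _ (trans (enum-index _) (trans (+-congʳ (enum-index _))
                        (trans (+-assoc _ _ _) (trans (+-congˡ (-‿inverseʳ 1#)) (+-identityʳ _)))))

  N·1≉0 : ¬ N · 1# ≈ 0#
  N·1≉0 N·1≈0 = proj₁ isField (trans (sym (+-identityʳ 1#)) (trans (+-congˡ (sym N·1≈0)) size·1≈0))

module PrimitiveElement {c ℓ} (R : CommutativeRing c ℓ) (isField : FF.IsField R) (N : ℕ) (size : FF.HasSize R (suc N))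
                        (α : CommutativeRing.Carrier R) (α-primitive : FF.IsPrimitive R α) (2≤N : 2 ≤ N) where
  open CommutativeRing R hiding (zero)
  open import Algebra.Properties.Monoid.Mult +-monoid using () renaming (_×_ to _·_)
  open import Algebra.Properties.Semiring.Sum semiring using (sum-syntax; sum-cong-≋; ∑-comm; *-distribˡ-sum; *-distribʳ-sum)
  open FF R
  open Polynomials R
  open PowersAndSums R
  open FieldLemmas R isField
  open FiniteField R isField N size

  α≉0 : ¬ α ≈ 0#
  α≉0 α≈0 = ℕ.<⇒≱ 2≤N (covering-bound 1 (λ _ → 1#) λ x x≉0 → Fin.zero , nonzero≈1 x x≉0 (α-primitive x x≉0))
    where
    nonzero≈1 : ∀ x → ¬ x ≈ 0# → Σ ℕ (λ i → x ≈ pow α i) → x ≈ 1#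
    nonzero≈1 x x≉0 (zero  , x≈1)   = x≈1
    nonzero≈1 x x≉0 (suc i , x≈ααⁱ) = ⊥-elim (x≉0 (trans x≈ααⁱ (trans (*-congʳ α≈0) (zeroˡ _))))

  order-bound : ∀ m → 0 < m → pow α m ≈ 1# → N ≤ m
  order-bound m@(suc _) _ αᵐ≈1 = covering-bound m (λ i → pow α (toℕ i)) λ x x≉0 → reduce x (α-primitive x x≉0)
    where
    reduce : ∀ x → Σ ℕ (λ i → x ≈ pow α i) → Σ (Fin m) λ i → x ≈ pow α (toℕ i)
    reduce x (i , x≈αⁱ) = Fin.fromℕ< (m%n<n i m) ,
      trans x≈αⁱ (trans (pow-% α m i αᵐ≈1) (reflexive (≡.cong (pow α) (≡.sym (FinP.toℕ-fromℕ< (m%n<n i m))))))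

  powers-distinct : ∀ i j → i < j → j < N → ¬ pow α i ≈ pow α j
  powers-distinct i j i<j j<N αⁱ≈αʲ = ℕ.<⇒≱ (ℕ.≤-<-trans (ℕ.m∸n≤m j i) j<N)
    (order-bound (j ∸ i) (ℕ.m<n⇒0<n∸m i<j) (pow-cancel i j α≉0 (ℕ.<⇒≤ i<j) αⁱ≈αʲ))

  α^N≈1 : pow α N ≈ 1#
  α^N≈1 with FinP.pigeonhole (ℕ.n<1+n N) (λ j → nonzeroIndex (pow α (toℕ j)) (pow-≉0 (toℕ j) α≉0))
  ... | i , j , i<j , same = ≡.subst (λ s → pow α s ≈ 1#) j-i≡N αʲ⁻ⁱ≈1
    where
    αⁱ≈αʲ : pow α (toℕ i) ≈ pow α (toℕ j)
    αⁱ≈αʲ = trans (sym (nonzeroAt-nonzeroIndex (pow α (toℕ i)) (pow-≉0 (toℕ i) α≉0)))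
                  (trans (reflexive (≡.cong nonzeroAt same)) (nonzeroAt-nonzeroIndex (pow α (toℕ j)) (pow-≉0 (toℕ j) α≉0)))
    αʲ⁻ⁱ≈1 : pow α (toℕ j ∸ toℕ i) ≈ 1#
    αʲ⁻ⁱ≈1 = pow-cancel (toℕ i) (toℕ j) α≉0 (ℕ.<⇒≤ i<j) αⁱ≈αʲ
    j-i≡N : toℕ j ∸ toℕ i ≡ N
    j-i≡N = ℕ.≤-antisym (ℕ.≤-trans (ℕ.m∸n≤m (toℕ j) (toℕ i)) (FinP.toℕ≤pred[n] j))
                        (order-bound _ (ℕ.m<n⇒0<n∸m i<j) αʲ⁻ⁱ≈1)

  α^s≉1 : ∀ s → 0 < s → s < N +ℕ N → ¬ s ≡ N → ¬ pow α s ≈ 1#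
  α^s≉1 s 0<s s<2N s≢N αˢ≈1 with ℕ.<-cmp s N
  ... | tri< s<N _ _ = ℕ.<⇒≱ s<N (order-bound s 0<s αˢ≈1)
  ... | tri≈ _ s≡N _ = s≢N s≡N
  ... | tri> _ _ N<s = ℕ.<⇒≱ s-N<N (order-bound (s ∸ N) (ℕ.m<n⇒0<n∸m N<s) αˢ⁻ᴺ≈1)
    where
    αˢ⁻ᴺ≈1 : pow α (s ∸ N) ≈ 1#
    αˢ⁻ᴺ≈1 = pow-cancel N s α≉0 (ℕ.<⇒≤ N<s) (trans α^N≈1 (sym αˢ≈1))
    s-N<N : s ∸ N < N
    s-N<N = ≡.subst (s ∸ N <_) (ℕ.m+n∸n≡m N N) (ℕ.∸-monoˡ-< s<2N (ℕ.<⇒≤ N<s))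

  dft-at-power : ∀ (u : Fin N → Carrier) t → 0 < t → t < N →
                 eval (dft α N u) (pow α t) ≈ coeff (fromFun N u) (N ∸ t) * (N · 1#)
  dft-at-power u t 0<t t<N = begin
    eval (dft α N u) (pow α t)
      ≈⟨ eval-fromFun N _ (pow α t) ⟩
    ∑[ j < N ] (sumF N (λ i → u i * pow α (toℕ i *ℕ toℕ j)) * pow (pow α t) (toℕ j))
      ≈⟨ sum-cong-≋ {N} (λ j → trans (*-congʳ (reflexive (sumF≡sum N _))) (*-distribʳ-sum {N} _ _)) ⟩
    ∑[ j < N ] ∑[ i < N ] (u i * pow α (toℕ i *ℕ toℕ j) * pow (pow α t) (toℕ j))
      ≈⟨ ∑-comm {N} {N} (λ j i → u i * pow α (toℕ i *ℕ toℕ j) * pow (pow α t) (toℕ j)) ⟩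
    ∑[ i < N ] ∑[ j < N ] (u i * pow α (toℕ i *ℕ toℕ j) * pow (pow α t) (toℕ j))
      ≈⟨ sum-cong-≋ {N} (λ i → trans (sum-cong-≋ {N} (term i)) (sym (*-distribˡ-sum {N} (u i) _))) ⟩
    ∑[ i < N ] (u i * powerSum N (pow α (toℕ i +ℕ t)))
      ≈⟨ sum-select N u _ (N ∸ t) (N · 1#) hit miss ⟩
    coeff (fromFun N u) (N ∸ t) * (N · 1#) ∎
    where
    open SetoidReasoning setoid
    term : ∀ i j → u i * pow α (toℕ i *ℕ toℕ j) * pow (pow α t) (toℕ j) ≈ u i * pow (pow α (toℕ i +ℕ t)) (toℕ j)
    term i j = trans (*-assoc _ _ _) (*-congˡ (begin
      pow α (toℕ i *ℕ toℕ j) * pow (pow α t) (toℕ j)        ≈⟨ *-congʳ (pow-* α (toℕ i) (toℕ j)) ⟩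
      pow (pow α (toℕ i)) (toℕ j) * pow (pow α t) (toℕ j)   ≈⟨ pow-distrib-* _ _ (toℕ j) ⟨
      pow (pow α (toℕ i) * pow α t) (toℕ j)                 ≈⟨ pow-congˡ (toℕ j) (pow-+ α (toℕ i) t) ⟨
      pow (pow α (toℕ i +ℕ t)) (toℕ j)                      ∎))
    hit : ∀ i → toℕ i ≡ N ∸ t → powerSum N (pow α (toℕ i +ℕ t)) ≈ N · 1#
    hit i i≡N-t = powerSum-1# N (trans (reflexive (≡.cong (pow α) i+t≡N)) α^N≈1)
      where
      i+t≡N : toℕ i +ℕ t ≡ N
      i+t≡N = ≡.trans (≡.cong (_+ℕ t) i≡N-t) (ℕ.m∸n+n≡m (ℕ.<⇒≤ t<N))
    miss : ∀ i → ¬ toℕ i ≡ N ∸ t → powerSum N (pow α (toℕ i +ℕ t)) ≈ 0#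
    miss i i≢N-t = powerSum-vanishes N αˢᴺ≈1 (α^s≉1 s 0<s s<2N s≢N)
      where
      s = toℕ i +ℕ t
      0<s : 0 < s
      0<s = ℕ.<-≤-trans 0<t (ℕ.m≤n+m t (toℕ i))
      s<2N : s < N +ℕ N
      s<2N = ℕ.+-mono-< (FinP.toℕ<n i) t<N
      s≢N : ¬ s ≡ N
      s≢N s≡N = i≢N-t (≡.trans (≡.sym (ℕ.m+n∸n≡m (toℕ i) t)) (≡.cong (_∸ t) s≡N))
      αˢᴺ≈1 : pow (pow α s) N ≈ 1#
      αˢᴺ≈1 = trans (sym (pow-* α s N)) (trans (reflexive (≡.cong (pow α) (ℕ.*-comm s N))) (pow-multiple-≈1 α N s α^N≈1))

  dft-root : ∀ u t → 0 < t → t < N → coeff (fromFun N u) (N ∸ t) ≈ 0# → eval (dft α N u) (pow α t) ≈ 0#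
  dft-root u t 0<t t<N uᴺ⁻ᵗ≈0 = trans (dft-at-power u t 0<t t<N) (trans (*-congʳ uᴺ⁻ᵗ≈0) (zeroˡ _))

  dft-nonroot : ∀ u t → 0 < t → t < N → ¬ coeff (fromFun N u) (N ∸ t) ≈ 0# → ¬ eval (dft α N u) (pow α t) ≈ 0#
  dft-nonroot u t 0<t t<N uᴺ⁻ᵗ≉0 Û≈0 = *-≉0 uᴺ⁻ᵗ≉0 N·1≉0 (trans (sym (dft-at-power u t 0<t t<N)) Û≈0)

  dft-decomposition : ∀ k d → k +ℕ d ≡ suc N → 1 ≤ k → 2 ≤ d → (u : Fin N → Carrier) →
    ¬ coeff (fromFun N u) (N ∸ 1) ≈ 0# →
    (∀ i → k ≤ i → i ≤ N ∸ 2 → coeff (fromFun N u) i ≈ 0#) →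
    Σ Carrier λ a → Σ (Fin k → Carrier) λ l →
      ¬ a ≈ 0# × ((a ·P g1Poly α d) +P (fromFun k l *P gPoly α d)) ≈P dft α N u
  dft-decomposition k (suc zero)    _ _ (s≤s ()) _ _ _
  dft-decomposition k (suc (suc n)) k+d≡1+N 1≤k _ u top gap =
    a , proj₁ split , a≉0 , coeff-≈ (≋-trans (proj₂ split) (≋-sym U≋g₁h))
    where
    U = dft α N u
    g₁ = prodRoots α 2 n

    N≡k+1+n : N ≡ k +ℕ suc n
    N≡k+1+n = ℕ.suc-injective (≡.trans (≡.sym k+d≡1+N) (ℕ.+-suc k (suc n)))

    2+n≤N : 2 +ℕ n ≤ N
    2+n≤N = ≡.subst (2 +ℕ n ≤_) (≡.sym N≡k+1+n) (ℕ.+-monoˡ-≤ (suc n) 1≤k)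

    roots : ∀ i → i < n → eval U (pow α (2 +ℕ i)) ≈ 0#
    roots i i<n = dft-root u (2 +ℕ i) (s≤s z≤n) (ℕ.<-≤-trans (s≤s (s≤s i<n)) 2+n≤N)
                           (gap (N ∸ (2 +ℕ i)) k≤N-2-i (ℕ.∸-monoʳ-≤ N (s≤s (s≤s z≤n))))
      where
      k≤N-2-i : k ≤ N ∸ (2 +ℕ i)
      k≤N-2-i = ℕ.m+n≤o⇒m≤o∸n k (≡.subst (k +ℕ (2 +ℕ i) ≤_) (≡.sym N≡k+1+n) (ℕ.+-monoʳ-≤ k (s≤s i<n)))

    factored = factor-powers α N powers-distinct n 2 U 2+n≤N roots
    h = proj₁ factored

    U≋g₁h : U ≋ (g₁ *P h)
    U≋g₁h = proj₁ (proj₂ factored)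

    length-h : length h ≡ suc k
    length-h = ≡.trans (proj₂ (proj₂ factored)) (≡.trans (≡.cong (_∸ n) (≡.trans (length-fromFun N _) N≡k+1+n))
                       (≡.trans (≡.cong (_∸ n) (ℕ.+-suc k n)) (ℕ.m+n∸n≡m (suc k) n)))

    a = eval h (pow α 1)
    split = cofactor-split (pow α 1) g₁ h k length-h

    a≉0 : ¬ a ≈ 0#
    a≉0 a≈0 = dft-nonroot u 1 (s≤s z≤n) 2≤N top (begin
      eval U (pow α 1)                        ≈⟨ eval-cong (pow α 1) U≋g₁h ⟩
      eval (g₁ *P h) (pow α 1)                ≈⟨ eval-*P g₁ h (pow α 1) ⟩
      eval g₁ (pow α 1) * a                   ≈⟨ trans (*-congˡ a≈0) (zeroʳ _) ⟩
      0#                                      ∎)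
      where open SetoidReasoning setoid

lemma3p2 : ∀ {c ℓ} (F : CommutativeRing c ℓ) → let open CommutativeRing F in let open FF F in
    (q : ℕ) → IsPrimePower q → IsField → HasSize q →
    (α : Carrier) → IsPrimitive α →
    (k : ℕ) → 1 ≤ k → k ≤ q ∸ 2 →
    (u : Fin (q ∸ 1) → Carrier) →
    ¬ (coeff (fromFun (q ∸ 1) u) (q ∸ 2) ≈ 0#) →
    (∀ (i : ℕ) → k ≤ i → i ≤ q ∸ 3 → coeff (fromFun (q ∸ 1) u) i ≈ 0#) →
    Σ Carrier λ a → Σ (Fin k → Carrier) λ l →
      ¬ (a ≈ 0#) ×
      ((a ·P g1Poly α (q ∸ k)) +P (fromFun k l *P gPoly α (q ∸ k))) ≈P dft α (q ∸ 1) u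
lemma3p2 F zero                   _ _ _ _ _ k (s≤s _) ()
lemma3p2 F (suc zero)             _ _ _ _ _ k (s≤s _) ()
lemma3p2 F (suc (suc zero))       _ _ _ _ _ k (s≤s _) ()
lemma3p2 F q@(suc N@(suc (suc r))) _ isField size α α-primitive k 1≤k k≤1+r =
  dft-decomposition k (q ∸ k) (ℕ.m+[n∸m]≡n k≤q) 1≤k (ℕ.m+n≤o⇒m≤o∸n 2 (s≤s (s≤s k≤1+r)))
  where
  open PrimitiveElement F isField N size α α-primitive (s≤s (s≤s z≤n))
  k≤q : k ≤ q
  k≤q = ℕ.m≤n⇒m≤1+n (ℕ.m≤n⇒m≤1+n k≤1+r)
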